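{- Let $\mathcal C$ and $\mathcal D$ be codes with $[\mathcal D]<[\mathcal C]$ in $\mathbf{P}_{\mathbf{Code}}$, and suppose $\mathcal D$ has exactly one fewer trunk than $\mathcal C$. Then $[\mathcal C]$ covers $[\mathcal D]$ in $\mathbf{P}_{\mathbf{Code}}$.
   Context: A code is a subset $\mathcal C\subseteq 2^{[n]}$. For $\sigma\subseteq[n]$, $\mathrm{Tk}_{\mathcal C}(\sigma)=\{c\in\mathcal C\mid\sigma\subseteq c\}$. A trunk in $\mathcal C$ is a subset of $\mathcal C$ that is empty or equal to $\mathrm{Tk}_{\mathcal C}(\sigma)$ for some $\sigma\subseteq[n]$; the number of trunks is the number of distinct such subsets. A morphism between codes $\mathcal C\subseteq 2^{[n]}$, $\mathcal D\subseteq 2^{[m]}$ is a function $f:\mathcal C\to\mathcal D$ such that the preimage of every trunk in $\mathcal D$ is a trunk in $\mathcal C$; an isomorphism is a bijective morphism whose inverse is a morphism. An operation on a code $\mathcal C$ consists of replacing $\mathcal C$ by one of its trunks (regarded as a code), or by its image $f(\mathcal C)$ under some morphism $f$. For isomorphism classes of codes, $[\mathcal C]\le[\mathcal D]$ if there is a finite sequence of operations taking $\mathcal D$ to a code isomorphic to $\mathcal C$; this is a partial order, and the resulting poset is denoted $\mathbf{P}_{\mathbf{Code}}$. $[\mathcal C]$ covers $[\mathcal D]$ if $[\mathcal D]<[\mathcal C]$ and there is no $[\mathcal E]$ with $[\mathcal D]<[\mathcal E]<[\mathcal C]$. -}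

module Defs where

open import Level using (Level) renaming (suc to lsuc)
open import Data.Nat using (ℕ)
open import Data.Bool using (Bool; true; false; T; _∧_; _∨_; not)
open import Data.Vec using ([]; _∷_)
open import Data.Fin.Subset using (Subset; _⊆_)
open import Data.Product using (Σ; ∃; _×_; _,_; proj₁)
open import Data.List using (List; length)
open import Data.List.Membership.Propositional using (_∈_)
open import Data.List.Relation.Unary.All using (All)
open import Data.List.Relation.Unary.AllPairs using (AllPairs)
open import Data.List.Relation.Unary.Any using (Any)
open import Data.Sum using (_⊎_)
open import Relation.Nullary using (¬_)
open import Relation.Binary.PropositionalEquality using (_≡_)
open import Relation.Binary.Construct.Closure.ReflexiveTransitive using (Star)

-- A code C ⊆ 2^[n]: the ambient n together with a (decidable) membership
-- predicate on subsets of [n] = Fin n.  (Finite, since Subset n is finite.)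
record Code : Set where
  constructor code
  field
    n   : ℕ
    mem : Subset n → Bool
open Code public

Elem : Code → Set
Elem C = Σ (Subset (n C)) (λ c → T (mem C c))

_⊆ᵇ_ : ∀ {k} → Subset k → Subset k → Bool
[] ⊆ᵇ [] = true
(a ∷ σ) ⊆ᵇ (b ∷ c) = (not a ∨ b) ∧ (σ ⊆ᵇ c)

_⇔_ : Set → Set → Set
A ⇔ B = (A → B) × (B → A)

IsTrunk : (C : Code) → (Elem C → Set) → Set
IsTrunk C P =
  (∀ c → ¬ P c) ⊎ Σ (Subset (n C)) (λ σ → ∀ c → P c ⇔ (σ ⊆ proj₁ c))

SameSubset : (C : Code) → (Elem C → Set) → (Elem C → Set) → Set
SameSubset C P Q = ∀ c → P c ⇔ Q c

HasTrunkCount : Code → ℕ → Set₁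
HasTrunkCount C k =
  Σ (List (Elem C → Set)) λ L →
    (length L ≡ k)
    × All (IsTrunk C) L
    × AllPairs (λ P Q → ¬ SameSubset C P Q) L
    × (∀ P → IsTrunk C P → Any (SameSubset C P) L)

IsMorphism : (C D : Code) → (Elem C → Elem D) → Set₁
IsMorphism C D f = ∀ P → IsTrunk D P → IsTrunk C (λ c → P (f c))

Iso : Code → Code → Set₁
Iso C D =
  Σ (Elem C → Elem D) λ f → Σ (Elem D → Elem C) λ g →
    IsMorphism C D f × IsMorphism D C g
    × (∀ c → proj₁ (g (f c)) ≡ proj₁ c)
    × (∀ d → proj₁ (f (g d)) ≡ proj₁ d)

trunkCode : (C : Code) → Subset (n C) → Code
trunkCode C σ = code (n C) (λ c → mem C c ∧ (σ ⊆ᵇ c))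

emptyCode : Code → Code
emptyCode C = code (n C) (λ _ → false)

data Op : Code → Code → Set₁ where
  trunkOp : (C : Code) (σ : Subset (n C)) → Op C (trunkCode C σ)
  emptyOp : (C : Code) → Op C (emptyCode C)
  imageOp : (C D : Code) (f : Elem C → Elem D) → IsMorphism C D f →
            ((d : Elem D) → Σ (Elem C) (λ c → proj₁ (f c) ≡ proj₁ d)) → Op C D

_≤P_ : Code → Code → Set₁
C ≤P D = Σ Code λ E → Star Op D E × Iso E C

_<P_ : Code → Code → Set₁
C <P D = (C ≤P D) × ¬ Iso C D

Covers : Code → Code → Set₁
Covers C D = (D <P C) × ¬ (Σ Code λ E → (D <P E) × (E <P C))

-- Pulling trunks back along the operations turns D ≤ E into an injective map
-- from the trunks of D to the trunks of E.  If this map hits every trunk of E,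
-- each operation in the chain is already an isomorphism, so for D < E some
-- trunk of E is missed.  Along D < E < C the k trunks of D thus give k + 1
-- distinct trunks of E and k + 2 distinct trunks of C, too many for k + 1.
module Submission where

open import Defs
open import Level using (0ℓ) renaming (suc to lsuc)
open import Data.Nat using (ℕ; zero; suc; _≤_; s≤s)
open import Data.Nat.Properties using (≮⇒≥; 1+n≰n)
open import Data.Bool using (Bool; true; false; T)
open import Data.Bool.Properties using (T-irrelevant; T-∧)
open import Data.Vec using ([]; _∷_; here; there)
open import Data.Fin using (zero; suc) renaming (_<_ to _<ᶠ_)
open import Data.Fin.Properties using (pigeonhole)
open import Data.Fin.Subset using (Subset; _⊆_; _∪_) renaming (⊥ to ∅)
open import Data.Fin.Subset.Properties
  using (⊆-antisym; ⊥⊆; p⊆p∪q; q⊆p∪q; x∈p∪q⁻; drop-∷-⊆)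
open import Data.Product using (Σ; _×_; _,_; proj₁; proj₂; swap)
open import Data.Sum using (inj₁; inj₂; [_,_])
open import Data.Empty using (⊥; ⊥-elim)
open import Data.Unit using (⊤; tt)
open import Data.List using (List; []; _∷_; length; map; lookup)
open import Data.List.Properties using (length-map)
open import Data.List.Membership.Propositional.Properties using (∈-lookup)
import Data.List.Relation.Unary.All as All
open All using (All; []; _∷_)
open import Data.List.Relation.Unary.All.Properties using () renaming (map⁺ to All-map⁺)
import Data.List.Relation.Unary.AllPairs as AllPairs
open AllPairs using (AllPairs; []; _∷_)
open import Data.List.Relation.Unary.AllPairs.Properties using ()
  renaming (map⁺ to AllPairs-map⁺)
open import Data.List.Relation.Unary.Any using (index)
open import Data.List.Relation.Unary.Any.Properties using (lookup-index)
open import Function using (_∘_; id)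
open import Function.Bundles using (Equivalence)
open import Relation.Nullary using (¬_)
open import Relation.Binary.Bundles using (Setoid)
open import Relation.Binary.Construct.Closure.ReflexiveTransitive using (Star; ε; _◅_)
open import Relation.Binary.PropositionalEquality
  using (_≡_; refl; sym; trans; cong; subst)

AllPairs-lookup : ∀ {a r} {A : Set a} {R : A → A → Set r} {xs : List A} →
                  AllPairs R xs → ∀ {i j} → i <ᶠ j → R (lookup xs i) (lookup xs j)
AllPairs-lookup (_ ∷ _)   {zero}  {zero}  ()
AllPairs-lookup (Rx ∷ _)  {zero}  {suc j} _         = All.lookup Rx (∈-lookup j)
AllPairs-lookup (_ ∷ _)   {suc i} {zero}  ()
AllPairs-lookup (_ ∷ Rxs) {suc i} {suc j} (s≤s i<j) = AllPairs-lookup Rxs i<j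

module _ {a ℓ} (S : Setoid a ℓ) where
  open Setoid S using (_≈_) renaming (sym to ≈-sym; trans to ≈-trans)
  open import Data.List.Membership.Setoid S using (_∈_)
  open import Data.List.Relation.Unary.Unique.Setoid S using (Unique)

  Unique-length≤ : ∀ {xs ys} → Unique xs → All (_∈ ys) xs → length xs ≤ length ys
  Unique-length≤ {xs} {ys} xs! xs⊆ys = ≮⇒≥ λ ys<xs →
    let position = λ i → All.lookup xs⊆ys (∈-lookup i)
        (i , j , i<j , same-position) = pigeonhole ys<xs (index ∘ position)
        xsⱼ≈ysₚ = subst (λ p → lookup xs j ≈ lookup ys p) (sym same-position)
                        (lookup-index (position j))
    in AllPairs-lookup xs! i<j (≈-trans (lookup-index (position i)) (≈-sym xsⱼ≈ysₚ))

Sub : Code → Set₁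
Sub C = Elem C → Set

Tk : (C : Code) → Subset (n C) → Sub C
Tk C σ c = σ ⊆ proj₁ c

Elem-≡ : (C : Code) {x y : Elem C} → proj₁ x ≡ proj₁ y → x ≡ y
Elem-≡ C {c , h} {.c , h′} refl = cong (c ,_) (T-irrelevant h h′)

SameSubset-setoid : Code → Setoid (lsuc 0ℓ) 0ℓ
SameSubset-setoid C = record
  { Carrier       = Sub C
  ; _≈_           = SameSubset C
  ; isEquivalence = record
    { refl  = λ _ → id , id
    ; sym   = λ P≈Q c → swap (P≈Q c)
    ; trans = λ P≈Q Q≈R c → proj₁ (Q≈R c) ∘ proj₁ (P≈Q c) , proj₂ (P≈Q c) ∘ proj₂ (Q≈R c)
    }
  }

IsTrunk-resp : (C : Code) {P Q : Sub C} → SameSubset C P Q → IsTrunk C P → IsTrunk C Q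
IsTrunk-resp C P≈Q (inj₁ P-empty)      = inj₁ λ c → P-empty c ∘ proj₂ (P≈Q c)
IsTrunk-resp C P≈Q (inj₂ (σ , P≈Tkσ)) = inj₂ (σ , ≈-trans (≈-sym P≈Q) P≈Tkσ)
  where open Setoid (SameSubset-setoid C) renaming (sym to ≈-sym; trans to ≈-trans)

IsTrunk-full : (C : Code) → IsTrunk C (λ _ → ⊤)
IsTrunk-full C = inj₂ (∅ , λ _ → (λ _ → ⊥⊆) , (λ _ → tt))

⊆ᵇ⇒⊆ : ∀ {k} (σ c : Subset k) → T (σ ⊆ᵇ c) → σ ⊆ c
⊆ᵇ⇒⊆ (true  ∷ σ) (true  ∷ c) σ⊆c here       = here
⊆ᵇ⇒⊆ (true  ∷ σ) (true  ∷ c) σ⊆c (there x∈σ) = there (⊆ᵇ⇒⊆ σ c σ⊆c x∈σ)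
⊆ᵇ⇒⊆ (false ∷ σ) (_     ∷ c) σ⊆c (there x∈σ) = there (⊆ᵇ⇒⊆ σ c σ⊆c x∈σ)

⊆⇒⊆ᵇ : ∀ {k} (σ c : Subset k) → σ ⊆ c → T (σ ⊆ᵇ c)
⊆⇒⊆ᵇ []          []          σ⊆c = tt
⊆⇒⊆ᵇ (true  ∷ σ) (true  ∷ c) σ⊆c = ⊆⇒⊆ᵇ σ c (drop-∷-⊆ σ⊆c)
⊆⇒⊆ᵇ (true  ∷ σ) (false ∷ c) σ⊆c with () ← σ⊆c here
⊆⇒⊆ᵇ (false ∷ σ) (_     ∷ c) σ⊆c = ⊆⇒⊆ᵇ σ c (drop-∷-⊆ σ⊆c)

¬¬-pull-Subset : ∀ {a k} {A : Subset k → Set a} → (∀ s → ¬ ¬ A s) → ¬ ¬ (∀ s → A s)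
¬¬-pull-Subset {k = zero}          ¬¬A ¬∀A = ¬¬A [] λ A[] → ¬∀A λ { [] → A[] }
¬¬-pull-Subset {k = suc k} {A = A} ¬¬A ¬∀A =
  ¬¬-pull-Subset {A = A ∘ (true ∷_)} (¬¬A ∘ (true ∷_)) λ A-true →
  ¬¬-pull-Subset {A = A ∘ (false ∷_)} (¬¬A ∘ (false ∷_)) λ A-false →
  ¬∀A λ { (true ∷ s) → A-true s ; (false ∷ s) → A-false s }

Iso-refl : (C : Code) → Iso C C
Iso-refl C = id , id , (λ _ → id) , (λ _ → id) , (λ _ → refl) , (λ _ → refl)

Iso-sym : {C D : Code} → Iso C D → Iso D C
Iso-sym (f , g , f-mor , g-mor , g∘f , f∘g) = g , f , g-mor , f-mor , f∘g , g∘f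

Iso-trans : {C D E : Code} → Iso C D → Iso D E → Iso C E
Iso-trans {D = D} (f , g , f-mor , g-mor , g∘f , f∘g) (f′ , g′ , f′-mor , g′-mor , g′∘f′ , f′∘g′) =
  f′ ∘ f , g ∘ g′ ,
  (λ P → f-mor _ ∘ f′-mor P) , (λ P → g′-mor _ ∘ g-mor P) ,
  (λ c → trans (cong (proj₁ ∘ g) (Elem-≡ D (g′∘f′ (f c)))) (g∘f c)) ,
  (λ e → trans (cong (proj₁ ∘ f′) (Elem-≡ D (f∘g (g′ e)))) (f′∘g′ e))

module _ {m} {p q : Subset m → Bool} (p⊆q : ∀ c → T (p c) → T (q c)) where

  inclusion : Elem (code m p) → Elem (code m q)
  inclusion (c , c∈p) = c , p⊆q c c∈p

  inclusion-isMorphism : IsMorphism (code m p) (code m q) inclusion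
  inclusion-isMorphism P (inj₁ P-empty)      = inj₁ (P-empty ∘ inclusion)
  inclusion-isMorphism P (inj₂ (τ , P≈Tkτ)) = inj₂ (τ , P≈Tkτ ∘ inclusion)

same-codewords⇒Iso : ∀ {m} {p q : Subset m → Bool} →
                     (∀ c → T (p c) → T (q c)) → (∀ c → T (q c) → T (p c)) →
                     Iso (code m p) (code m q)
same-codewords⇒Iso p⊆q q⊆p =
  inclusion p⊆q , inclusion q⊆p ,
  inclusion-isMorphism p⊆q , inclusion-isMorphism q⊆p ,
  (λ _ → refl) , (λ _ → refl)

record TrunkEmbedding (Y X : Code) : Set₁ where
  field
    embed           : Sub Y → Sub X
    embed-isTrunk   : ∀ P → IsTrunk Y P → IsTrunk X (embed P)
    embed-reflects≈ : ∀ P Q → SameSubset X (embed P) (embed Q) → SameSubset Y P Q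
open TrunkEmbedding

-- Hitting a trunk is only asked for up to double negation: this is what
-- makes "not onto" yield a missed trunk constructively.
Onto : {Y X : Code} → TrunkEmbedding Y X → Set₁
Onto {Y} {X} e =
  ∀ M → IsTrunk X M → ¬ ¬ Σ (Sub Y) λ P → IsTrunk Y P × SameSubset X M (embed e P)

MissedTrunk : {Y X : Code} → TrunkEmbedding Y X → Set₁
MissedTrunk {Y} {X} e =
  Σ (Sub X) λ M → IsTrunk X M × (∀ P → IsTrunk Y P → ¬ SameSubset X M (embed e P))

¬Onto⇒¬¬MissedTrunk : {Y X : Code} (e : TrunkEmbedding Y X) → ¬ Onto e → ¬ ¬ MissedTrunk e
¬Onto⇒¬¬MissedTrunk e ¬onto ¬missed =
  ¬onto λ M M-trunk ¬hit → ¬missed (M , M-trunk , λ P P-trunk M≈eP → ¬hit (P , P-trunk , M≈eP))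

TrunkEmbedding-id : (X : Code) → TrunkEmbedding X X
TrunkEmbedding-id X = record
  { embed = id ; embed-isTrunk = λ _ → id ; embed-reflects≈ = λ _ _ → id }

_∘ᵀ_ : {Z Y X : Code} → TrunkEmbedding Y X → TrunkEmbedding Z Y → TrunkEmbedding Z X
e₁ ∘ᵀ e₂ = record
  { embed           = embed e₁ ∘ embed e₂
  ; embed-isTrunk   = λ P → embed-isTrunk e₁ _ ∘ embed-isTrunk e₂ P
  ; embed-reflects≈ = λ P Q → embed-reflects≈ e₂ P Q ∘ embed-reflects≈ e₁ _ _
  }

Onto-∘ˡ : {Z Y X : Code} (e₁ : TrunkEmbedding Y X) (e₂ : TrunkEmbedding Z Y) →
          Onto (e₁ ∘ᵀ e₂) → Onto e₁
Onto-∘ˡ e₁ e₂ onto M M-trunk ¬hit =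
  onto M M-trunk λ (P , P-trunk , M≈P) → ¬hit (embed e₂ P , embed-isTrunk e₂ P P-trunk , M≈P)

Onto-∘ʳ : {Z Y X : Code} (e₁ : TrunkEmbedding Y X) (e₂ : TrunkEmbedding Z Y) →
          Onto (e₁ ∘ᵀ e₂) → Onto e₂
Onto-∘ʳ e₁ e₂ onto M M-trunk ¬hit =
  onto (embed e₁ M) (embed-isTrunk e₁ M M-trunk) λ (P , P-trunk , e₁M≈P) →
    ¬hit (P , P-trunk , embed-reflects≈ e₁ M (embed e₂ P) e₁M≈P)

module _ {C D : Code} (f : Elem C → Elem D) (f-mor : IsMorphism C D f)
         (f-onto : (d : Elem D) → Σ (Elem C) λ c → proj₁ (f c) ≡ proj₁ d) where

  private
    g : Elem D → Elem C
    g = proj₁ ∘ f-onto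

    f∘g : ∀ d → f (g d) ≡ d
    f∘g d = Elem-≡ D (proj₂ (f-onto d))

  preimage-embedding : TrunkEmbedding D C
  preimage-embedding = record
    { embed           = _∘ f
    ; embed-isTrunk   = f-mor
    ; embed-reflects≈ = λ P Q P∘f≈Q∘f d →
        (λ Pd → subst Q (f∘g d) (proj₁ (P∘f≈Q∘f (g d)) (subst P (sym (f∘g d)) Pd))) ,
        (λ Qd → subst P (f∘g d) (proj₂ (P∘f≈Q∘f (g d)) (subst Q (sym (f∘g d)) Qd)))
    }

  -- Once every Tk σ is a preimage of a trunk of D, the codeword c is recovered
  -- from f c as the least codeword whose image lies in the trunk for σ = c.
  preimage-onto⇒¬¬Iso : Onto preimage-embedding → ¬ ¬ Iso C D
  preimage-onto⇒¬¬Iso onto ¬iso =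
    ¬¬-pull-Subset (λ σ → onto (Tk C σ) (inj₂ (σ , λ _ → id , id))) (¬iso ∘ iso)
    where
    module _ (pulled : ∀ σ → Σ (Sub D) λ P → IsTrunk D P × SameSubset C (Tk C σ) (P ∘ f)) where

      f-reflects-⊆ : ∀ c c′ → proj₁ (f c) ≡ proj₁ (f c′) → proj₁ c ⊆ proj₁ c′
      f-reflects-⊆ c c′ fc≡fc′ =
        proj₂ (Tk≈P∘f c′) (subst P (Elem-≡ D fc≡fc′) (proj₁ (Tk≈P∘f c) id))
        where
        P      = proj₁ (pulled (proj₁ c))
        Tk≈P∘f = proj₂ (proj₂ (pulled (proj₁ c)))

      g∘f : ∀ c → proj₁ (g (f c)) ≡ proj₁ c
      g∘f c = ⊆-antisym (f-reflects-⊆ _ _ fgfc≡fc) (f-reflects-⊆ _ _ (sym fgfc≡fc))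
        where fgfc≡fc = proj₂ (f-onto (f c))

      g-mor : IsMorphism D C g
      g-mor Q (inj₁ Q-empty)      = inj₁ (Q-empty ∘ g)
      g-mor Q (inj₂ (σ , Q≈Tkσ)) = IsTrunk-resp D P≈Q∘g P-trunk
        where
        P       = proj₁ (pulled σ)
        P-trunk = proj₁ (proj₂ (pulled σ))
        Tk≈P∘f  = proj₂ (proj₂ (pulled σ))
        P≈Q∘g : SameSubset D P (Q ∘ g)
        P≈Q∘g d =
          (λ Pd → proj₂ (Q≈Tkσ (g d)) (proj₂ (Tk≈P∘f (g d)) (subst P (sym (f∘g d)) Pd))) ,
          (λ Qgd → subst P (f∘g d) (proj₁ (Tk≈P∘f (g d)) (proj₁ (Q≈Tkσ (g d)) Qgd)))

      iso : Iso C D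
      iso = f , g , f-mor , g-mor , g∘f , proj₂ ∘ f-onto

Iso-embedding : {C D : Code} → Iso C D → TrunkEmbedding D C
Iso-embedding (f , g , f-mor , _ , _ , f∘g) = preimage-embedding f f-mor (λ d → g d , f∘g d)

module _ (C : Code) (σ : Subset (n C)) where

  private
    Y = trunkCode C σ

    into : (c : Elem C) → T (σ ⊆ᵇ proj₁ c) → Elem Y
    into (c , c∈C) σ⊆c = c , Equivalence.from T-∧ (c∈C , σ⊆c)

    out : Elem Y → Elem C
    out (c , c∈Y) = c , proj₁ (Equivalence.to T-∧ c∈Y)

    σ⊆out : ∀ y → T (σ ⊆ᵇ proj₁ (out y))
    σ⊆out (c , c∈Y) = proj₂ (Equivalence.to T-∧ c∈Y)

    into-out : ∀ y σ⊆y → into (out y) σ⊆y ≡ y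
    into-out y _ = Elem-≡ Y refl

  trunk-embedding : TrunkEmbedding Y C
  trunk-embedding = record
    { embed           = extend
    ; embed-isTrunk   = extend-isTrunk
    ; embed-reflects≈ = λ P Q eP≈eQ y →
        (λ Py → subst Q (into-out y _) (proj₂ (proj₁ (eP≈eQ (out y)) (in-extend P y Py)))) ,
        (λ Qy → subst P (into-out y _) (proj₂ (proj₂ (eP≈eQ (out y)) (in-extend Q y Qy))))
    }
    where
    extend : Sub Y → Sub C
    extend P c = Σ (T (σ ⊆ᵇ proj₁ c)) (P ∘ into c)

    in-extend : ∀ P y → P y → extend P (out y)
    in-extend P y Py = σ⊆out y , subst P (sym (into-out y _)) Py

    extend-isTrunk : ∀ P → IsTrunk Y P → IsTrunk C (extend P)
    extend-isTrunk P (inj₁ P-empty)      = inj₁ λ c → P-empty _ ∘ proj₂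
    extend-isTrunk P (inj₂ (τ , P≈Tkτ)) = inj₂ (σ ∪ τ , λ c →
      (λ (σ⊆c , Pc) → ∪-⊆ (⊆ᵇ⇒⊆ σ _ σ⊆c) (proj₁ (P≈Tkτ (into c σ⊆c)) Pc)) ,
      (λ σ∪τ⊆c → ⊆⇒⊆ᵇ σ _ (σ∪τ⊆c ∘ p⊆p∪q τ) , proj₂ (P≈Tkτ _) (σ∪τ⊆c ∘ q⊆p∪q σ τ)))
      where
      ∪-⊆ : ∀ {c} → σ ⊆ c → τ ⊆ c → σ ∪ τ ⊆ c
      ∪-⊆ σ⊆c τ⊆c = [ σ⊆c , τ⊆c ] ∘ x∈p∪q⁻ σ τ

  trunk-onto⇒¬¬Iso : Onto trunk-embedding → ¬ ¬ Iso C Y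
  trunk-onto⇒¬¬Iso onto ¬iso = onto (λ _ → ⊤) (IsTrunk-full C) λ (_ , _ , ⊤≈eP) →
    ¬iso (same-codewords⇒Iso
      (λ c c∈C → Equivalence.from T-∧ (c∈C , proj₁ (proj₁ (⊤≈eP (c , c∈C)) tt)))
      (λ c → proj₁ ∘ Equivalence.to T-∧))

empty-embedding : (C : Code) → TrunkEmbedding (emptyCode C) C
empty-embedding C = record
  { embed           = λ _ _ → ⊤
  ; embed-isTrunk   = λ _ _ → IsTrunk-full C
  ; embed-reflects≈ = λ _ _ _ y → ⊥-elim (proj₂ y)
  }

empty-onto⇒¬¬Iso : (C : Code) → Onto (empty-embedding C) → ¬ ¬ Iso C (emptyCode C)
empty-onto⇒¬¬Iso C onto ¬iso = onto (λ _ → ⊥) (inj₁ λ _ ()) λ (_ , _ , ⊥≈⊤) →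
  ¬iso (same-codewords⇒Iso (λ c c∈C → ⊥-elim (proj₂ (⊥≈⊤ (c , c∈C)) tt)) (λ _ ()))

Op-embedding : {X Y : Code} → Op X Y → TrunkEmbedding Y X
Op-embedding (trunkOp C σ)                 = trunk-embedding C σ
Op-embedding (emptyOp C)                   = empty-embedding C
Op-embedding (imageOp C D f f-mor f-onto) = preimage-embedding f f-mor f-onto

Op-onto⇒¬¬Iso : {X Y : Code} (o : Op X Y) → Onto (Op-embedding o) → ¬ ¬ Iso X Y
Op-onto⇒¬¬Iso (trunkOp C σ)                 = trunk-onto⇒¬¬Iso C σ
Op-onto⇒¬¬Iso (emptyOp C)                   = empty-onto⇒¬¬Iso C
Op-onto⇒¬¬Iso (imageOp C D f f-mor f-onto) = preimage-onto⇒¬¬Iso f f-mor f-onto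

Star-embedding : {X Y : Code} → Star Op X Y → TrunkEmbedding Y X
Star-embedding {X} ε = TrunkEmbedding-id X
Star-embedding (o ◅ os) = Op-embedding o ∘ᵀ Star-embedding os

Star-onto⇒¬¬Iso : {X Y : Code} (os : Star Op X Y) → Onto (Star-embedding os) → ¬ ¬ Iso X Y
Star-onto⇒¬¬Iso {X} ε _ ¬iso = ¬iso (Iso-refl X)
Star-onto⇒¬¬Iso (o ◅ os) onto ¬iso =
  Op-onto⇒¬¬Iso o (Onto-∘ˡ (Op-embedding o) (Star-embedding os) onto) λ iso₁ →
  Star-onto⇒¬¬Iso os (Onto-∘ʳ (Op-embedding o) (Star-embedding os) onto) λ iso₂ →
  ¬iso (Iso-trans iso₁ iso₂)

<P⇒¬Onto : {D E : Code} → D <P E → Σ (TrunkEmbedding D E) λ e → ¬ Onto e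
<P⇒¬Onto ((E′ , os , E′≅D) , ¬E≅D) =
  Star-embedding os ∘ᵀ Iso-embedding E′≅D ,
  λ onto → Star-onto⇒¬¬Iso os (Onto-∘ˡ (Star-embedding os) (Iso-embedding E′≅D) onto)
             λ E≅E′ → ¬E≅D (Iso-sym (Iso-trans E≅E′ E′≅D))

DistinctTrunks : (X : Code) → List (Sub X) → Set₁
DistinctTrunks X L = All (IsTrunk X) L × AllPairs (λ P Q → ¬ SameSubset X P Q) L

DistinctTrunks-extend : {Y X : Code} (e : TrunkEmbedding Y X) (missed : MissedTrunk e) →
                        ∀ {L} → DistinctTrunks Y L →
                        DistinctTrunks X (proj₁ missed ∷ map (embed e) L)
DistinctTrunks-extend e (M , M-trunk , M-missed) (L-trunks , L-distinct) =
  M-trunk ∷ All-map⁺ (All.map (embed-isTrunk e _) L-trunks) ,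
  All-map⁺ (All.map (M-missed _) L-trunks) ∷
  AllPairs-map⁺ (AllPairs.map (λ P≉Q → P≉Q ∘ embed-reflects≈ e _ _) L-distinct)

<P⇒longer-DistinctTrunks : {D E : Code} → D <P E → ∀ {L} → DistinctTrunks D L →
  ¬ ¬ Σ (List (Sub E)) λ L′ → DistinctTrunks E L′ × length L′ ≡ suc (length L)
<P⇒longer-DistinctTrunks D<E {L} L-distinct ¬longer =
  ¬Onto⇒¬¬MissedTrunk e ¬onto λ missed →
    ¬longer (_ , DistinctTrunks-extend e missed L-distinct , cong suc (length-map (embed e) L))
  where
  e     = proj₁ (<P⇒¬Onto D<E)
  ¬onto = proj₂ (<P⇒¬Onto D<E)

DistinctTrunks-length≤ : {X : Code} {m : ℕ} → HasTrunkCount X m →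
                         ∀ {L} → DistinctTrunks X L → length L ≤ m
DistinctTrunks-length≤ {X} (LX , LX-length , _ , _ , LX-complete) (L-trunks , L-distinct) =
  subst (_ ≤_) LX-length
    (Unique-length≤ (SameSubset-setoid X) L-distinct (All.map (LX-complete _) L-trunks))

corollary3p18 : (C D : Code) (k : ℕ) →
    D <P C → HasTrunkCount C (suc k) → HasTrunkCount D k → Covers C D
corollary3p18 C D k D<C C-count (LD , LD-length , LD-trunks , LD-distinct , _) =
  D<C , λ (E , D<E , E<C) →
    <P⇒longer-DistinctTrunks D<E (LD-trunks , LD-distinct) λ (LE , LE-distinct , LE-length) →
    <P⇒longer-DistinctTrunks E<C LE-distinct λ (LC , LC-distinct , LC-length) →
    1+n≰n (subst (_≤ suc k) (too-many LE-length LC-length)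
                 (DistinctTrunks-length≤ C-count LC-distinct))
  where
  too-many : ∀ {lE lC} → lE ≡ suc (length LD) → lC ≡ suc lE → lC ≡ suc (suc k)
  too-many refl refl = cong (λ l → suc (suc l)) LD-length
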